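{- Let $Q$ be an odd prime power and $F_5(X):=X-\mathrm{Tr}_{Q^4/Q^2}(X^{Q^3-Q+1})=X-X^{Q^3-Q+1}-X^{Q^2(Q^3-Q+1)}$. Then the only root of $F_5(X)$ in $\mathbb{F}_{Q^4}$ is $0$.
   Context: $\mathrm{Tr}_{Q^4/Q^2}(X)$ denotes the polynomial $X^{Q^2}+X$. -}

module Defs where

open import Level using (Level; _⊔_)
open import Data.Nat as ℕ using (ℕ; suc; _≥_; _∸_)
open import Data.Nat.Primality using (Prime)
open import Data.Nat.Divisibility using (_∣_)
open import Data.Fin using (Fin)
open import Data.Product using (Σ; ∃; _×_; _,_)
open import Relation.Nullary using (¬_)
open import Relation.Binary.PropositionalEquality using (_≡_)
open import Algebra.Bundles using (CommutativeRing; Semiring)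
import Algebra.Definitions.RawSemiring as RawSemiringDefs

IsOddPrimePower : ℕ → Set
IsOddPrimePower Q =
  Σ ℕ λ p → Σ ℕ λ k → Prime p × ¬ (2 ∣ p) × k ≥ 1 × Q ≡ p ℕ.^ k

IsField : ∀ {c ℓ} → CommutativeRing c ℓ → Set (c ⊔ ℓ)
IsField R = ¬ (1# ≈ 0#) × (∀ x → ¬ (x ≈ 0#) → Σ Carrier λ y → x * y ≈ 1#)
  where open CommutativeRing R

HasCardinality : ∀ {c ℓ} → CommutativeRing c ℓ → ℕ → Set (c ⊔ ℓ)
HasCardinality R n =
  Σ (Fin n → Carrier) λ e →
    (∀ i j → e i ≈ e j → i ≡ j) × (∀ x → Σ (Fin n) λ i → e i ≈ x)
  where open CommutativeRing R

pow : ∀ {c ℓ} (R : CommutativeRing c ℓ) → CommutativeRing.Carrier R → ℕ → CommutativeRing.Carrier R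
pow R = RawSemiringDefs._^_ (Semiring.rawSemiring (CommutativeRing.semiring R))

Tr42 : ∀ {c ℓ} (R : CommutativeRing c ℓ) → ℕ → CommutativeRing.Carrier R → CommutativeRing.Carrier R
Tr42 R Q x = pow R x (Q ℕ.^ 2) + x
  where open CommutativeRing R

F5 : ∀ {c ℓ} (R : CommutativeRing c ℓ) → ℕ → CommutativeRing.Carrier R → CommutativeRing.Carrier R
F5 R Q x = x - Tr42 R Q (pow R x (Q ℕ.^ 3 ∸ Q ℕ.+ 1))
  where open CommutativeRing R

{-# OPTIONS --safe #-}
-- Put y = x ^ (Q³ - Q + 1), so that F₅(x) = 0 says x = y ^ Q² + y.  In a field with Q⁴
-- elements z ↦ z ^ Q² is additive (Frobenius, the characteristic p divides Q) and squares to
-- the identity (Fermat: z ^ Q⁴ = z).  Hence x ^ Q² = x, then y ^ Q² = y and x = y + y.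
-- Moreover x ^ Q³ = x ^ Q, so y · x ^ Q = x ^ (Q³ + 1) = x · x ^ Q.  Multiplying x = y + y
-- by x ^ Q gives x ^ (Q + 1) = 2 x ^ (Q + 1), so x ^ (Q + 1) = 0 and x = 0.
module Submission where

open import Defs
open import Algebra.Bundles using (CommutativeRing; CommutativeMonoid)
import Algebra.Properties.AbelianGroup as AbelianGroupProperties
import Algebra.Properties.CommutativeMonoid.Sum as Sum
import Algebra.Properties.CommutativeSemigroup as CommutativeSemigroupProperties
import Algebra.Properties.CommutativeSemiring.Binomial as Binomial
import Algebra.Properties.Semiring.Exp as Exp
import Algebra.Properties.Semiring.Mult as Mult
open import Level using (_⊔_)
open import Data.Fin as Fin using (Fin; zero; suc; inject₁; fromℕ; punchIn)
open import Data.Fin.Permutation using (Permutation; permutation; _⟨$⟩ʳ_)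
open import Data.Fin.Properties using (toℕ-fromℕ; inject₁ℕ<; punchInᵢ≢i)
open import Data.Nat as ℕ using (ℕ; zero; suc; _∸_; _<_; _≤_; _!; NonZero; z≤n; z<s; s<s; nonTrivial⇒≢1)
open import Data.Nat.Combinatorics using (_C_; nCk≡n!/k![n-k]!; k![n∸k]!∣n!; nCn≡1)
open import Data.Nat.Divisibility using (_∣_; _∤_; divides; ∣⇒≤; ∣1⇒≡1; m∣m*n)
open import Data.Nat.DivMod using (_/_; m/n*n≡m)
open import Data.Nat.Primality using (Prime; euclidsLemma; prime⇒nonZero; prime⇒nonTrivial)
open import Data.Nat.Properties
  using (<⇒≱; <-trans; n<1+n; <⇒≤; ∸-monoʳ-<; _!*_!≢0; n∸n≡0; m+[n∸m]≡n; m≤m*n; ^-*-assoc; ^-distribˡ-+-*)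
import Data.Nat.Properties as ℕₚ
open import Data.Product using (_,_; proj₁; proj₂)
open import Data.Sum using (inj₁; inj₂)
open import Data.Vec.Functional using (Vector; removeAt)
open import Relation.Binary.Definitions using (Decidable)
open import Relation.Binary.PropositionalEquality using (_≡_; _≢_; refl; cong; cong₂; subst; module ≡-Reasoning)
import Relation.Binary.PropositionalEquality as ≡
open import Relation.Nullary using (¬_; yes; no; contradiction)
open import Relation.Nullary.Decidable using (map′)


n∣n! : ∀ {n} .{{_ : NonZero n}} → n ∣ n !
n∣n! {suc n} = m∣m*n (n !)

prime∤m! : ∀ {p m} → Prime p → m < p → p ∤ m !
prime∤m! {m = zero}  p-prime _   p∣1  = nonTrivial⇒≢1 {{prime⇒nonTrivial p-prime}} (∣1⇒≡1 p∣1)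
prime∤m! {m = suc m} p-prime m<p p∣m! with euclidsLemma (suc m) (m !) p-prime p∣m!
... | inj₁ p∣1+m = <⇒≱ m<p (∣⇒≤ p∣1+m)
... | inj₂ p∣m!  = prime∤m! p-prime (<-trans (n<1+n m) m<p) p∣m!

nCk*k!*[n∸k]!≡n! : ∀ {n k} → k ≤ n → (n C k) ℕ.* (k ! ℕ.* (n ∸ k) !) ≡ n !
nCk*k!*[n∸k]!≡n! {n} {k} k≤n = begin
  (n C k) ℕ.* (k ! ℕ.* (n ∸ k) !)                     ≡⟨ cong (ℕ._* (k ! ℕ.* (n ∸ k) !)) (nCk≡n!/k![n-k]! k≤n) ⟩
  n ! / (k ! ℕ.* (n ∸ k) !) ℕ.* (k ! ℕ.* (n ∸ k) !)  ≡⟨ m/n*n≡m (k![n∸k]!∣n! k≤n) ⟩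
  n !                                                 ∎
  where
  open ≡-Reasoning
  instance _ = k !* (n ∸ k) !≢0

prime∤k!*[p∸k]! : ∀ {p k} → Prime p → 0 < k → k < p → p ∤ k ! ℕ.* (p ∸ k) !
prime∤k!*[p∸k]! {p} {k} p-prime 0<k k<p p∣k!*[p∸k]!
  with euclidsLemma (k !) ((p ∸ k) !) p-prime p∣k!*[p∸k]!
... | inj₁ p∣k!     = prime∤m! p-prime k<p p∣k!
... | inj₂ p∣[p∸k]! = prime∤m! p-prime (∸-monoʳ-< 0<k (<⇒≤ k<p)) p∣[p∸k]!

prime∣pCk : ∀ {p k} → Prime p → 0 < k → k < p → p ∣ p C k
prime∣pCk {p} {k} p-prime 0<k k<p with euclidsLemma (p C k) (k ! ℕ.* (p ∸ k) !) p-prime p∣p!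
  where
  instance _ = prime⇒nonZero p-prime
  p∣p! : p ∣ (p C k) ℕ.* (k ! ℕ.* (p ∸ k) !)
  p∣p! = subst (p ∣_) (≡.sym (nCk*k!*[n∸k]!≡n! (<⇒≤ k<p))) n∣n!
... | inj₁ p∣pCk       = p∣pCk
... | inj₂ p∣k!*[p∸k]! = contradiction p∣k!*[p∸k]! (prime∤k!*[p∸k]! p-prime 0<k k<p)

n≤n^3 : ∀ n → n ≤ n ℕ.^ 3
n≤n^3 zero    = z≤n
n≤n^3 (suc n) = m≤m*n (suc n) (suc n ℕ.^ 2)

q³∸q+1+q≡1+q³ : ∀ q → (q ℕ.^ 3 ∸ q ℕ.+ 1) ℕ.+ q ≡ suc (q ℕ.^ 3)
q³∸q+1+q≡1+q³ q = begin
  (q ℕ.^ 3 ∸ q ℕ.+ 1) ℕ.+ q ≡⟨ ℕₚ.+-comm _ q ⟩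
  q ℕ.+ (q ℕ.^ 3 ∸ q ℕ.+ 1) ≡⟨ ℕₚ.+-assoc q (q ℕ.^ 3 ∸ q) 1 ⟨
  q ℕ.+ (q ℕ.^ 3 ∸ q) ℕ.+ 1 ≡⟨ cong (ℕ._+ 1) (m+[n∸m]≡n (n≤n^3 q)) ⟩
  q ℕ.^ 3 ℕ.+ 1             ≡⟨ ℕₚ.+-comm (q ℕ.^ 3) 1 ⟩
  suc (q ℕ.^ 3)             ∎
  where open ≡-Reasoning

module _ {a ℓ} (M : CommutativeMonoid a ℓ) where
  open CommutativeMonoid M
  open Sum M using (sum; sum-remove; sum-cong-≋)
  open CommutativeSemigroupProperties commutativeSemigroup using (x∙yz≈y∙xz)
  open import Relation.Binary.Reasoning.Setoid setoid

  sum-exchange : ∀ {n} (f g : Vector Carrier n) i → (∀ j → j ≢ i → f j ≈ g j) →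
                 f i ∙ sum g ≈ g i ∙ sum f
  sum-exchange {suc n} f g i f≈g = begin
    f i ∙ sum g                      ≈⟨ ∙-congˡ (sum-remove {i = i} g) ⟩
    f i ∙ (g i ∙ sum (removeAt g i)) ≈⟨ x∙yz≈y∙xz (f i) (g i) _ ⟩
    g i ∙ (f i ∙ sum (removeAt g i)) ≈⟨ ∙-congˡ (∙-congˡ (sum-cong-≋ f≈g∖i)) ⟨
    g i ∙ (f i ∙ sum (removeAt f i)) ≈⟨ ∙-congˡ (sum-remove {i = i} f) ⟨
    g i ∙ sum f                      ∎
    where
    f≈g∖i : ∀ j → removeAt f i j ≈ removeAt g i j
    f≈g∖i j = f≈g (punchIn i j) (punchInᵢ≢i i j)

module _ {c ℓ} (R : CommutativeRing c ℓ) where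
  open CommutativeRing R hiding (zero; refl)
  open Exp semiring using (_^_; ^-congˡ; ^-congʳ; ^-assocʳ; ^-homo-*)
  open Mult semiring using (_×_; ×-congʳ; ×-assoc-*; ×1-homo-*)
  open Binomial commutativeSemiring using (theorem; binomialTerm)
  open Sum +-commutativeMonoid using (sum; sum-init-last; sum-cong-≋; sum-replicate-zero)
  open import Relation.Binary.Reasoning.Setoid setoid

  IsAdditivePower : ℕ → Set (c ⊔ ℓ)
  IsAdditivePower e = ∀ a b → (a + b) ^ e ≈ a ^ e + b ^ e

  isAdditivePower-* : ∀ {e f} → IsAdditivePower e → IsAdditivePower f → IsAdditivePower (e ℕ.* f)
  isAdditivePower-* {e} {f} additive-e additive-f a b = begin
    (a + b) ^ (e ℕ.* f)           ≈⟨ ^-assocʳ (a + b) e f ⟨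
    ((a + b) ^ e) ^ f             ≈⟨ ^-congˡ f (additive-e a b) ⟩
    (a ^ e + b ^ e) ^ f           ≈⟨ additive-f (a ^ e) (b ^ e) ⟩
    (a ^ e) ^ f + (b ^ e) ^ f     ≈⟨ +-cong (^-assocʳ a e f) (^-assocʳ b e f) ⟩
    a ^ (e ℕ.* f) + b ^ (e ℕ.* f) ∎

  isAdditivePower-^ : ∀ {e} → IsAdditivePower e → ∀ j → IsAdditivePower (e ℕ.^ j)
  isAdditivePower-^ additive-e zero    = distribʳ 1#
  isAdditivePower-^ {e} additive-e (suc j) =
    isAdditivePower-* {e} {e ℕ.^ j} additive-e (isAdditivePower-^ additive-e j)

  freshmans-dream : ∀ n .{{_ : NonZero n}} → (∀ {k} x → 0 < k → k < n → (n C k) × x ≈ 0#) →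
                    IsAdditivePower n
  freshmans-dream (suc m) middle≈0 a b = begin
    (a + b) ^ p                                                        ≈⟨ theorem p a b ⟩
    T zero + sum (λ i → T (suc i))                                     ≈⟨ +-congˡ (sum-init-last (λ i → T (suc i))) ⟩
    T zero + (sum (λ i → T (suc (inject₁ i))) + T (suc (fromℕ m)))    ≈⟨ +-cong first (+-cong middle last) ⟩
    b ^ p + (0# + a ^ p)                                               ≈⟨ +-congˡ (+-identityˡ _) ⟩
    b ^ p + a ^ p                                                      ≈⟨ +-comm _ _ ⟩
    a ^ p + b ^ p                                                      ∎
    where
    p = suc m
    T = binomialTerm a b p
    first : T zero ≈ b ^ p
    first = trans (+-identityʳ _) (*-identityˡ _)
    middle : sum (λ i → T (suc (inject₁ i))) ≈ 0#
    middle = trans (sum-cong-≋ (λ i → middle≈0 _ z<s (s<s (inject₁ℕ< i)))) (sum-replicate-zero m)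
    last : T (suc (fromℕ m)) ≈ a ^ p
    last = begin
      T (suc (fromℕ m))               ≡⟨ cong (λ k → (p C k) × (a ^ k * b ^ (p ∸ k))) (cong suc (toℕ-fromℕ m)) ⟩
      (p C p) × (a ^ p * b ^ (p ∸ p)) ≡⟨ cong₂ (λ c k → c × (a ^ p * b ^ k)) (nCn≡1 p) (n∸n≡0 p) ⟩
      1 × (a ^ p * 1#)                ≈⟨ +-identityʳ _ ⟩
      a ^ p * 1#                      ≈⟨ *-identityʳ _ ⟩
      a ^ p                           ∎

  char∣⇒×≈0 : ∀ {p k} → p × 1# ≈ 0# → p ∣ k → ∀ x → k × x ≈ 0#
  char∣⇒×≈0 {p} p×1≈0 (divides q refl) x = begin
    (q ℕ.* p) × x                 ≈⟨ ×-congʳ (q ℕ.* p) (*-identityˡ x) ⟨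
    (q ℕ.* p) × (1# * x)          ≈⟨ ×-assoc-* (q ℕ.* p) 1# x ⟨
    ((q ℕ.* p) × 1#) * x          ≈⟨ *-congʳ (×1-homo-* q p) ⟩
    ((q × 1#) * (p × 1#)) * x     ≈⟨ *-congʳ (trans (*-congˡ p×1≈0) (zeroʳ _)) ⟩
    0# * x                        ≈⟨ zeroˡ x ⟩
    0#                            ∎

  frobenius : ∀ {p} → Prime p → p × 1# ≈ 0# → IsAdditivePower p
  frobenius {p} p-prime p×1≈0 = freshmans-dream p middle≈0
    where
    instance _ = prime⇒nonZero p-prime
    middle≈0 : ∀ {k} x → 0 < k → k < p → (p C k) × x ≈ 0#
    middle≈0 x 0<k k<p = char∣⇒×≈0 p×1≈0 (prime∣pCk p-prime 0<k k<p) x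

  ×1-homo-^ : ∀ p m → (p ℕ.^ m) × 1# ≈ (p × 1#) ^ m
  ×1-homo-^ p zero    = +-identityʳ 1#
  ×1-homo-^ p (suc m) = trans (×1-homo-* p (p ℕ.^ m)) (*-congˡ (×1-homo-^ p m))

  Tr42^q²≈Tr42 : ∀ q → IsAdditivePower (q ℕ.^ 2) → (∀ y → y ^ (q ℕ.^ 4) ≈ y) →
                 ∀ y → Tr42 R q y ^ (q ℕ.^ 2) ≈ Tr42 R q y
  Tr42^q²≈Tr42 q additive y^q⁴≈y y = begin
    (y ^ q² + y) ^ q²        ≈⟨ additive (y ^ q²) y ⟩
    (y ^ q²) ^ q² + y ^ q²   ≈⟨ +-congʳ (^-assocʳ y q² q²) ⟩
    y ^ (q² ℕ.* q²) + y ^ q² ≈⟨ +-congʳ (^-congʳ y (^-distribˡ-+-* q 2 2)) ⟨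
    y ^ (q ℕ.^ 4) + y ^ q²   ≈⟨ +-congʳ (y^q⁴≈y y) ⟩
    y + y ^ q²               ≈⟨ +-comm y (y ^ q²) ⟩
    y ^ q² + y               ∎
    where
    q² = q ℕ.^ 2

  ^[q³∸q+1]*^q≈^[1+q] : ∀ q {x} → x ^ (q ℕ.^ 2) ≈ x → x ^ (q ℕ.^ 3 ∸ q ℕ.+ 1) * x ^ q ≈ x ^ suc q
  ^[q³∸q+1]*^q≈^[1+q] q {x} x^q²≈x = begin
    x ^ e * x ^ q          ≈⟨ ^-homo-* x e q ⟨
    x ^ (e ℕ.+ q)          ≡⟨ cong (x ^_) (q³∸q+1+q≡1+q³ q) ⟩
    x * x ^ (q ℕ.^ 3)      ≡⟨ cong (λ k → x * x ^ k) (ℕₚ.*-comm q (q ℕ.^ 2)) ⟩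
    x * x ^ (q ℕ.^ 2 ℕ.* q) ≈⟨ *-congˡ (^-assocʳ x (q ℕ.^ 2) q) ⟨
    x * (x ^ (q ℕ.^ 2)) ^ q ≈⟨ *-congˡ (^-congˡ q x^q²≈x) ⟩
    x * x ^ q              ∎
    where
    e = q ℕ.^ 3 ∸ q ℕ.+ 1

module FieldProperties {c ℓ} (R : CommutativeRing c ℓ) (isField : IsField R) where
  open CommutativeRing R hiding (zero; refl)
  open Exp semiring using (_^_)
  open Sum *-commutativeMonoid using (sum)
  open import Relation.Binary.Reasoning.Setoid setoid

  1≉0 : ¬ 1# ≈ 0#
  1≉0 = proj₁ isField

  module Inverse {a} (a≉0 : ¬ a ≈ 0#) where
    a⁻¹ : Carrier
    a⁻¹ = proj₁ (proj₂ isField a a≉0)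

    a⁻¹*[a*x]≈x : ∀ x → a⁻¹ * (a * x) ≈ x
    a⁻¹*[a*x]≈x x = begin
      a⁻¹ * (a * x) ≈⟨ *-assoc a⁻¹ a x ⟨
      (a⁻¹ * a) * x ≈⟨ *-congʳ (trans (*-comm a⁻¹ a) (proj₂ (proj₂ isField a a≉0))) ⟩
      1# * x        ≈⟨ *-identityˡ x ⟩
      x             ∎

    a*[a⁻¹*x]≈x : ∀ x → a * (a⁻¹ * x) ≈ x
    a*[a⁻¹*x]≈x x = begin
      a * (a⁻¹ * x) ≈⟨ *-assoc a a⁻¹ x ⟨
      (a * a⁻¹) * x ≈⟨ *-congʳ (proj₂ (proj₂ isField a a≉0)) ⟩
      1# * x        ≈⟨ *-identityˡ x ⟩
      x             ∎

  *-cancelˡ-≉0 : ∀ {a x y} → ¬ a ≈ 0# → a * x ≈ a * y → x ≈ y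
  *-cancelˡ-≉0 {a} {x} {y} a≉0 ax≈ay = begin
    x             ≈⟨ a⁻¹*[a*x]≈x x ⟨
    a⁻¹ * (a * x) ≈⟨ *-congˡ ax≈ay ⟩
    a⁻¹ * (a * y) ≈⟨ a⁻¹*[a*x]≈x y ⟩
    y             ∎
    where open Inverse a≉0

  *-≉0 : ∀ {a b} → ¬ a ≈ 0# → ¬ b ≈ 0# → ¬ a * b ≈ 0#
  *-≉0 {a} a≉0 b≉0 ab≈0 = b≉0 (*-cancelˡ-≉0 a≉0 (trans ab≈0 (sym (zeroʳ a))))

  ^-≉0 : ∀ {a} → ¬ a ≈ 0# → ∀ m → ¬ a ^ m ≈ 0#
  ^-≉0 a≉0 zero    = 1≉0
  ^-≉0 a≉0 (suc m) = *-≉0 a≉0 (^-≉0 a≉0 m)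

  ∏-≉0 : ∀ {m} (f : Vector Carrier m) → (∀ i → ¬ f i ≈ 0#) → ¬ sum f ≈ 0#
  ∏-≉0 {zero}  f f≉0 = 1≉0
  ∏-≉0 {suc m} f f≉0 = *-≉0 (f≉0 zero) (∏-≉0 (λ i → f (suc i)) (λ i → f≉0 (suc i)))

  ^≈0⇒≈0 : Decidable _≈_ → ∀ m {a} → a ^ m ≈ 0# → a ≈ 0#
  ^≈0⇒≈0 _≈?_ m {a} a^m≈0 with a ≈? 0#
  ... | yes a≈0 = a≈0
  ... | no a≉0  = contradiction a^m≈0 (^-≉0 a≉0 m)

module FiniteField {c ℓ} (R : CommutativeRing c ℓ) (isField : IsField R) {n} (card : HasCardinality R n) where
  open CommutativeRing R hiding (zero) renaming (refl to ≈-refl)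
  open FieldProperties R isField
  open Exp semiring using (_^_; ^-congˡ)
  open Mult semiring using (_×_)
  open AbelianGroupProperties +-abelianGroup using (identityʳ-unique; //-rightDividesˡ; //-rightDividesʳ)
  module ∑ = Sum +-commutativeMonoid
  module ∏ = Sum *-commutativeMonoid
  open import Relation.Binary.Reasoning.Setoid setoid

  element : Fin n → Carrier
  element = proj₁ card

  element-injective : ∀ i j → element i ≈ element j → i ≡ j
  element-injective = proj₁ (proj₂ card)

  indexOf : Carrier → Fin n
  indexOf x = proj₁ (proj₂ (proj₂ card) x)

  element-indexOf : ∀ x → element (indexOf x) ≈ x
  element-indexOf x = proj₂ (proj₂ (proj₂ card) x)

  _≈?_ : Decidable _≈_
  x ≈? y = map′ indexOf≡⇒≈ ≈⇒indexOf≡ (indexOf x Fin.≟ indexOf y)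
    where
    indexOf≡⇒≈ : indexOf x ≡ indexOf y → x ≈ y
    indexOf≡⇒≈ ix≡iy = begin
      x                    ≈⟨ element-indexOf x ⟨
      element (indexOf x)  ≡⟨ cong element ix≡iy ⟩
      element (indexOf y)  ≈⟨ element-indexOf y ⟩
      y                    ∎
    ≈⇒indexOf≡ : x ≈ y → indexOf x ≡ indexOf y
    ≈⇒indexOf≡ x≈y = element-injective _ _ (trans (element-indexOf x) (trans x≈y (sym (element-indexOf y))))

  module Relabel (σ τ : Carrier → Carrier)
                 (σ-cong : ∀ {x y} → x ≈ y → σ x ≈ σ y) (τ-cong : ∀ {x y} → x ≈ y → τ x ≈ τ y)
                 (σ∘τ≈id : ∀ x → σ (τ x) ≈ x) (τ∘σ≈id : ∀ x → τ (σ x) ≈ x) where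
    relabel : Permutation n n
    relabel = permutation (along σ) (along τ) (along-inverse σ-cong σ∘τ≈id) (along-inverse τ-cong τ∘σ≈id)
      where
      along : (Carrier → Carrier) → Fin n → Fin n
      along f i = indexOf (f (element i))
      along-inverse : ∀ {f g} → (∀ {x y} → x ≈ y → f x ≈ f y) → (∀ x → f (g x) ≈ x) →
                      ∀ i → along f (along g i) ≡ i
      along-inverse {f} {g} f-cong f∘g≈id i = element-injective _ _ (begin
        element (along f (along g i)) ≈⟨ element-indexOf _ ⟩
        f (element (along g i))       ≈⟨ f-cong (element-indexOf _) ⟩
        f (g (element i))             ≈⟨ f∘g≈id (element i) ⟩
        element i                     ∎)

    element-relabel : ∀ i → element (relabel ⟨$⟩ʳ i) ≈ σ (element i)
    element-relabel i = element-indexOf _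

  -- Translation by 1 permutes the elements, so Σ x = Σ (x + 1) = Σ x + n · 1.
  n×1≈0 : n × 1# ≈ 0#
  n×1≈0 = identityʳ-unique S (n × 1#) (sym (begin
    S                                        ≈⟨ ∑.∑-permute element relabel ⟩
    ∑.sum (λ i → element (relabel ⟨$⟩ʳ i))   ≈⟨ ∑.sum-cong-≋ element-relabel ⟩
    ∑.sum (λ i → element i + 1#)             ≈⟨ ∑.∑-distrib-+ element (λ _ → 1#) ⟩
    S + ∑.sum {n} (λ _ → 1#)                 ≈⟨ +-congˡ (∑.sum-replicate n) ⟩
    S + n × 1#                               ∎))
    where
    S = ∑.sum element
    open Relabel (_+ 1#) (_- 1#) +-congʳ +-congʳ (//-rightDividesˡ 1#) (//-rightDividesʳ 1#)

  characteristic : ∀ {p m} → n ≡ p ℕ.^ m → p × 1# ≈ 0#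
  characteristic {p} {m} n≡p^m = ^≈0⇒≈0 _≈?_ m (begin
    (p × 1#) ^ m    ≈⟨ ×1-homo-^ R p m ⟨
    (p ℕ.^ m) × 1#  ≡⟨ cong (_× 1#) n≡p^m ⟨
    n × 1#          ≈⟨ n×1≈0 ⟩
    0#              ∎)

  zeroIndex : Fin n
  zeroIndex = indexOf 0#

  ≈0⇒≡zeroIndex : ∀ {i} → element i ≈ 0# → i ≡ zeroIndex
  ≈0⇒≡zeroIndex ei≈0 = element-injective _ _ (trans ei≈0 (sym (element-indexOf 0#)))

  nonzeroElement : Fin n → Carrier
  nonzeroElement i with i Fin.≟ zeroIndex
  ... | yes _ = 1#
  ... | no _  = element i

  nonzeroElement-zeroIndex : nonzeroElement zeroIndex ≈ 1#
  nonzeroElement-zeroIndex with zeroIndex Fin.≟ zeroIndex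
  ... | yes _ = ≈-refl
  ... | no z≢z = contradiction refl z≢z

  nonzeroElement-≢ : ∀ {i} → i ≢ zeroIndex → nonzeroElement i ≈ element i
  nonzeroElement-≢ {i} i≢z with i Fin.≟ zeroIndex
  ... | yes i≡z = contradiction i≡z i≢z
  ... | no _    = ≈-refl

  nonzeroElement-≉0 : ∀ i → ¬ nonzeroElement i ≈ 0#
  nonzeroElement-≉0 i with i Fin.≟ zeroIndex
  ... | yes _   = 1≉0
  ... | no i≢z  = λ ei≈0 → i≢z (≈0⇒≡zeroIndex ei≈0)

  module _ {x} (x≉0 : ¬ x ≈ 0#) where
    open Inverse x≉0 renaming (a⁻¹ to x⁻¹)
    open Relabel (x *_) (x⁻¹ *_) *-congˡ *-congˡ a*[a⁻¹*x]≈x a⁻¹*[a*x]≈x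

    relabel-zeroIndex : relabel ⟨$⟩ʳ zeroIndex ≡ zeroIndex
    relabel-zeroIndex = ≈0⇒≡zeroIndex (begin
      element (relabel ⟨$⟩ʳ zeroIndex) ≈⟨ element-relabel zeroIndex ⟩
      x * element zeroIndex            ≈⟨ *-congˡ (element-indexOf 0#) ⟩
      x * 0#                           ≈⟨ zeroʳ x ⟩
      0#                               ∎)

    relabel-≢ : ∀ {i} → i ≢ zeroIndex → relabel ⟨$⟩ʳ i ≢ zeroIndex
    relabel-≢ {i} i≢z πi≡z = i≢z (≈0⇒≡zeroIndex (*-cancelˡ-≉0 x≉0 (begin
      x * element i               ≈⟨ element-relabel i ⟨
      element (relabel ⟨$⟩ʳ i)    ≡⟨ cong element πi≡z ⟩
      element zeroIndex           ≈⟨ element-indexOf 0# ⟩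
      0#                          ≈⟨ zeroʳ x ⟨
      x * 0#                      ∎)))

    relabel-nonzeroElement : ∀ i → i ≢ zeroIndex → nonzeroElement (relabel ⟨$⟩ʳ i) ≈ x * nonzeroElement i
    relabel-nonzeroElement i i≢z = begin
      nonzeroElement (relabel ⟨$⟩ʳ i) ≈⟨ nonzeroElement-≢ (relabel-≢ i≢z) ⟩
      element (relabel ⟨$⟩ʳ i)        ≈⟨ element-relabel i ⟩
      x * element i                   ≈⟨ *-congˡ (nonzeroElement-≢ i≢z) ⟨
      x * nonzeroElement i            ∎

    -- Multiplication by x permutes the nonzero elements, so their product P satisfies
    -- P = x ^ (n - 1) · P; the zero element contributes the factor 1 on both sides.
    ^n≈id-≉0 : x ^ n ≈ x
    ^n≈id-≉0 = *-cancelˡ-≉0 (∏-≉0 nonzeroElement nonzeroElement-≉0) (begin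
      P * x ^ n                                        ≈⟨ *-comm P (x ^ n) ⟩
      x ^ n * P                                        ≈⟨ *-congʳ (∏.sum-replicate n) ⟨
      ∏.sum {n} (λ _ → x) * P                          ≈⟨ ∏.∑-distrib-+ (λ _ → x) nonzeroElement ⟨
      ∏.sum (λ i → x * nonzeroElement i)               ≈⟨ *-identityˡ _ ⟨
      1# * ∏.sum (λ i → x * nonzeroElement i)          ≈⟨ *-congʳ first ⟨
      g zeroIndex * ∏.sum (λ i → x * nonzeroElement i) ≈⟨ sum-exchange *-commutativeMonoid g _ zeroIndex relabel-nonzeroElement ⟩
      (x * nonzeroElement zeroIndex) * ∏.sum g         ≈⟨ *-cong x*nonzeroElement-zeroIndex (sym (∏.∑-permute nonzeroElement relabel)) ⟩
      x * P                                            ≈⟨ *-comm x P ⟩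
      P * x                                            ∎)
      where
      P = ∏.sum nonzeroElement
      g : Fin n → Carrier
      g i = nonzeroElement (relabel ⟨$⟩ʳ i)
      x*nonzeroElement-zeroIndex : x * nonzeroElement zeroIndex ≈ x
      x*nonzeroElement-zeroIndex = trans (*-congˡ nonzeroElement-zeroIndex) (*-identityʳ x)
      first : g zeroIndex ≈ 1#
      first = trans (reflexive (cong nonzeroElement relabel-zeroIndex)) nonzeroElement-zeroIndex

  ^n≈id : ∀ x → x ^ n ≈ x
  ^n≈id x with x ≈? 0#
  ... | no x≉0  = ^n≈id-≉0 x≉0
  ... | yes x≈0 = begin
    x ^ n   ≈⟨ ^-congˡ n x≈0 ⟩
    0# ^ n  ≈⟨ 0^m≈0 zeroIndex ⟩
    0#      ≈⟨ x≈0 ⟨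
    x       ∎
    where
    0^m≈0 : ∀ {m} → Fin m → 0# ^ m ≈ 0#
    0^m≈0 {suc m} _ = zeroˡ _

module _ {c ℓ} (R : CommutativeRing c ℓ) (isField : IsField R) (_≈?_ : Decidable (CommutativeRing._≈_ R)) where
  open CommutativeRing R hiding (zero; refl)
  open FieldProperties R isField using (^≈0⇒≈0)
  open Exp semiring using (_^_; ^-congˡ; ^-assocʳ)
  open AbelianGroupProperties +-abelianGroup using (identityʳ-unique; x∙y⁻¹≈ε⇒x≈y)
  open import Relation.Binary.Reasoning.Setoid setoid

  F5≈0⇒≈0 : ∀ q → IsAdditivePower R (q ℕ.^ 2) → (∀ y → y ^ (q ℕ.^ 4) ≈ y) →
            ∀ x → F5 R q x ≈ 0# → x ≈ 0#
  F5≈0⇒≈0 q additive y^q⁴≈y x F5x≈0 = ^≈0⇒≈0 _≈?_ (suc q) (identityʳ-unique a a a+a≈a)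
    where
    q² = q ℕ.^ 2
    e = q ℕ.^ 3 ∸ q ℕ.+ 1
    y = x ^ e
    a = x ^ suc q

    x≈Tr42[y] : x ≈ Tr42 R q y
    x≈Tr42[y] = x∙y⁻¹≈ε⇒x≈y x (Tr42 R q y) F5x≈0

    x^q²≈x : x ^ q² ≈ x
    x^q²≈x = begin
      x ^ q²              ≈⟨ ^-congˡ q² x≈Tr42[y] ⟩
      Tr42 R q y ^ q²     ≈⟨ Tr42^q²≈Tr42 R q additive y^q⁴≈y y ⟩
      Tr42 R q y          ≈⟨ x≈Tr42[y] ⟨
      x                   ∎

    y^q²≈y : y ^ q² ≈ y
    y^q²≈y = begin
      (x ^ e) ^ q²   ≈⟨ ^-assocʳ x e q² ⟩
      x ^ (e ℕ.* q²) ≡⟨ cong (x ^_) (ℕₚ.*-comm e q²) ⟩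
      x ^ (q² ℕ.* e) ≈⟨ ^-assocʳ x q² e ⟨
      (x ^ q²) ^ e   ≈⟨ ^-congˡ e x^q²≈x ⟩
      x ^ e          ∎

    a+a≈a : a + a ≈ a
    a+a≈a = begin
      a + a                      ≈⟨ +-cong y*x^q≈a y*x^q≈a ⟨
      y * x ^ q + y * x ^ q      ≈⟨ distribʳ (x ^ q) y y ⟨
      (y + y) * x ^ q            ≈⟨ *-congʳ (trans x≈Tr42[y] (+-congʳ y^q²≈y)) ⟨
      a                          ∎
      where
      y*x^q≈a : y * x ^ q ≈ a
      y*x^q≈a = ^[q³∸q+1]*^q≈^[1+q] R q x^q²≈x

open import Data.Nat using (_^_)

lemma6p2 : ∀ {c ℓ} (Q : ℕ) → IsOddPrimePower Q →
    (R : CommutativeRing c ℓ) → IsField R → HasCardinality R (Q ^ 4) →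
    ∀ x → CommutativeRing._≈_ R (F5 R Q x) (CommutativeRing.0# R) →
    CommutativeRing._≈_ R x (CommutativeRing.0# R)
lemma6p2 Q (p , k , p-prime , _ , _ , refl) R isField card =
  F5≈0⇒≈0 R isField _≈?_ Q frobenius-Q² ^n≈id
  where
  open FiniteField R isField card
  frobenius-p : IsAdditivePower R p
  frobenius-p = frobenius R p-prime (characteristic {p} {k ℕ.* 4} (^-*-assoc p k 4))
  frobenius-Q² : IsAdditivePower R (Q ^ 2)
  frobenius-Q² = isAdditivePower-^ R {Q} (isAdditivePower-^ R {p} frobenius-p k) 2
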